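{- Status injective trees are status unique in trees: if $T$ is a tree whose vertices have pairwise distinct statuses, and $T'$ is any tree with $\sigma(T')=\sigma(T)$, then $T'$ is isomorphic to $T$.
   Context: For a vertex $v$ of a connected graph $G=(V,E)$, the status of $v$ is $s(v)=\sum_{u\in V} d(v,u)$, where $d$ is the shortest-path distance. The status sequence $\sigma(G)$ is the list of the statuses of all vertices of $G$, arranged in nondecreasing order. A connected graph is status injective if the statuses of its vertices are pairwise distinct. -}

module Defs where

open import Data.Nat using (ℕ; zero; suc; _≤_; _+_)
open import Data.Fin using (Fin; zero; suc; inject₁; fromℕ)
open import Data.List using (List; tabulate)
open import Data.Nat.ListAction using (sum)
open import Data.Product using (Σ; ∃; _×_; _,_)
open import Function.Definitions using (Injective)
open import Function.Bundles using (Bijection; _⤖_; _⇔_)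
open import Relation.Binary.PropositionalEquality using (_≡_)
open import Relation.Nullary using (¬_)
import Data.Nat.Properties as ℕP
import Data.List.Sort
import Data.Fin.Properties

record Graph (n : ℕ) : Set₁ where
  field
    Adj     : Fin n → Fin n → Set
    Adj-sym : ∀ {u v} → Adj u v → Adj v u
    irrefl  : ∀ {u} → ¬ Adj u u
open Graph public

data Walk {n : ℕ} (G : Graph n) : Fin n → Fin n → ℕ → Set where
  here : ∀ {u} → Walk G u u zero
  step : ∀ {u w v k} → Adj G u w → Walk G w v k → Walk G u v (suc k)

Connected : ∀ {n} → Graph n → Set
Connected G = ∀ u v → ∃ λ k → Walk G u v k

-- A cycle of length m+3: distinct vertices f 0, …, f (m+2), consecutive ones
-- adjacent, and f (m+2) adjacent to f 0.
record Cycle {n : ℕ} (G : Graph n) : Set where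
  field
    m       : ℕ
    vert    : Fin (suc (suc (suc m))) → Fin n
    distinct : Injective _≡_ _≡_ vert
    consec  : ∀ (i : Fin (suc (suc m))) → Adj G (vert (inject₁ i)) (vert (suc i))
    closing : Adj G (vert (fromℕ (suc (suc m)))) (vert zero)

Acyclic : ∀ {n} → Graph n → Set
Acyclic G = ¬ Cycle G

IsTree : ∀ {n} → Graph n → Set
IsTree {n} G = (1 ≤ n) × Connected G × Acyclic G

IsDist : ∀ {n} → Graph n → Fin n → Fin n → ℕ → Set
IsDist G u v d = Walk G u v d × (∀ {k} → Walk G u v k → d ≤ k)

IsStatus : ∀ {n} → Graph n → Fin n → ℕ → Set
IsStatus {n} G v s =
  Σ (Fin n → ℕ) λ d → (∀ u → IsDist G v u (d u)) × (s ≡ sum (tabulate d))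

StatusFunction : ∀ {n} → Graph n → (Fin n → ℕ) → Set
StatusFunction G st = ∀ v → IsStatus G v (st v)

open Data.List.Sort ℕP.≤-decTotalOrder using (sort)

statusSeq : ∀ {n} → (Fin n → ℕ) → List ℕ
statusSeq st = sort (tabulate st)

record Iso {n n′ : ℕ} (G : Graph n) (H : Graph n′) : Set where
  field
    bij  : Fin n ⤖ Fin n′
    pres : ∀ u v → Adj G u v ⇔ Adj H (Bijection.to bij u) (Bijection.to bij v)

-- Root a status-injective tree T at its vertex of minimum status. Along an edge uv,
-- s(v) - s(u) = |T_u| - |T_v| where T_u, T_v are the two components of T - uv, so status
-- increases away from the root and every other vertex c has a unique neighbour p of smaller
-- status, with s(c) + 2|T_c| = s(p) + n, where T_c is the subtree hanging from c. Hence p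
-- is the unique vertex satisfying this equation, and the subtree sizes obey the recursion
-- |T_x| = 1 + Σ { |T_c| : x is the parent of c }, whose right-hand side only involves
-- vertices of larger status. By downward induction on the status, both the subtree sizes
-- and the edges of T are therefore determined by the status sequence, and any tree T′ with
-- σ(T′) = σ(T) is isomorphic to T via the status-preserving bijection of vertex sets.
module Submission where

open import Defs
open import Data.Nat as ℕ using (ℕ; zero; suc; _+_; _≤_; _<_; s≤s; _<?_)
open import Data.Nat.Properties hiding (_≟_)
import Data.Nat.ListAction as List
open import Data.Fin using (Fin; zero; suc; inject₁; fromℕ; _≟_)
import Data.Fin.Properties as Fin
open import Data.Fin.Permutation using (Permutation; _⟨$⟩ʳ_; permutation; ↔⇒≡)
open import Data.List using (tabulate)
open import Data.List.Membership.Propositional using (_∈_)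
open import Data.List.Membership.Propositional.Properties using (∈-tabulate⁺; ∈-tabulate⁻)
open import Data.List.Relation.Binary.Permutation.Propositional using (_↭_; ↭-sym; ↭-trans; ↭⇒↭ₛ)
open import Data.List.Relation.Binary.Permutation.Propositional.Properties using (∈-resp-↭)
import Data.List.Relation.Binary.Permutation.Setoid.Properties as ↭ₛ
open import Data.List.Relation.Unary.Unique.Propositional using (Unique; _∷_)
open import Data.List.Relation.Unary.Unique.Propositional.Properties
  using (tabulate⁺; Unique[x∷xs]⇒x∉xs)
import Data.List.Sort
open import Data.Product using (Σ; ∃-syntax; _×_; _,_; proj₁; proj₂)
open import Data.Sum using (_⊎_; inj₁; inj₂) renaming (map to ⊎-map; map₁ to ⊎-map₁)
open import Data.Unit using (⊤; tt)
open import Data.Empty using (⊥; ⊥-elim)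
open import Function using (_∘_)
open import Function.Bundles using (Bijection; _⇔_; mk⇔; Equivalence)
open import Function.Definitions using (Injective)
import Function.Properties.Equivalence as ⇔
open import Function.Properties.Inverse using (↔⇒⤖)
open import Relation.Binary.Definitions using (tri<; tri≈; tri>)
open import Relation.Binary.PropositionalEquality
open import Relation.Nullary using (¬_; Dec; yes; no; contradiction)
open import Relation.Nullary.Decidable using (_×-dec_; ¬?; map′)
open import Algebra.Properties.Semiring.Sum +-*-semiring
  using (sum; sum-syntax; sum-cong-≗; sum-replicate-zero; ∑-distrib-+; ∑-comm; ∑-permute)

open ≡-Reasoning

when : ∀ {p} {P : Set p} → Dec P → ℕ → ℕ
when (yes _) m = m
when (no _)  _ = 0

module _ {p} {P : Set p} {m : ℕ} where

  when-yes : (P? : Dec P) → P → when P? m ≡ m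
  when-yes (yes _) _ = refl
  when-yes (no ¬p) p = contradiction p ¬p

  when-no : (P? : Dec P) → ¬ P → when P? m ≡ 0
  when-no (yes p) ¬p = contradiction p ¬p
  when-no (no _)  _  = refl

when-cong : ∀ {p q} {P : Set p} {Q : Set q} (P? : Dec P) (Q? : Dec Q) {m m′ : ℕ} →
            P ⇔ Q → (P → m ≡ m′) → when P? m ≡ when Q? m′
when-cong (yes p) (yes _) _   m≡m′ = m≡m′ p
when-cong (yes p) (no ¬q) P⇔Q _    = contradiction (Equivalence.to P⇔Q p) ¬q
when-cong (no ¬p) (yes q) P⇔Q _    = contradiction (Equivalence.from P⇔Q q) ¬p
when-cong (no _)  (no _)  _   _    = refl

when-sum : ∀ {p} {P : Set p} (P? : Dec P) {n} (f : Fin n → ℕ) →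
           when P? (sum f) ≡ ∑[ i < n ] when P? (f i)
when-sum (yes _)     f = refl
when-sum (no _) {n}  f = sym (sum-replicate-zero n)

when-suc< : ∀ a → when (suc a <? a) 1 ≡ 0
when-suc< a = when-no (suc a <? a) (<-asym (n<1+n a))

when-<suc : ∀ a → when (a <? suc a) 1 ≡ 1
when-<suc a = when-yes (a <? suc a) (n<1+n a)

when-<-adjacent : ∀ {a b} → b ≡ suc a ⊎ a ≡ suc b → when (b <? a) 1 + when (a <? b) 1 ≡ 1
when-<-adjacent {a} (inj₁ refl) = cong₂ _+_ (when-suc< a) (when-<suc a)
when-<-adjacent {b = b} (inj₂ refl) = cong₂ _+_ (when-<suc b) (when-suc< b)

+-when-<-adjacent : ∀ {a b} → b ≡ suc a ⊎ a ≡ suc b → b + when (b <? a) 1 ≡ a + when (a <? b) 1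
+-when-<-adjacent {a} (inj₁ refl) = begin
  suc a + when (suc a <? a) 1 ≡⟨ cong (suc a +_) (when-suc< a) ⟩
  suc a + 0                   ≡⟨ +-identityʳ (suc a) ⟩
  suc a                       ≡⟨ +-comm 1 a ⟩
  a + 1                       ≡⟨ cong (a +_) (when-<suc a) ⟨
  a + when (a <? suc a) 1     ∎
+-when-<-adjacent {b = b} (inj₂ refl) = sym (+-when-<-adjacent {b} (inj₁ refl))

sum-tabulate : ∀ {n} (f : Fin n → ℕ) → List.sum (tabulate f) ≡ sum f
sum-tabulate {zero}  f = refl
sum-tabulate {suc n} f = cong (f zero +_) (sum-tabulate (f ∘ suc))

∑-one : ∀ n → ∑[ i < n ] 1 ≡ n
∑-one zero    = refl
∑-one (suc n) = cong suc (∑-one n)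

∑-single : ∀ {n} (f : Fin n → ℕ) a → (∀ i → i ≢ a → f i ≡ 0) → sum f ≡ f a
∑-single {suc n} f zero f≡0 = begin
  f zero + sum (f ∘ suc)     ≡⟨ cong (f zero +_) (sum-cong-≗ (λ i → f≡0 (suc i) λ ())) ⟩
  f zero + sum {n} (λ _ → 0) ≡⟨ cong (f zero +_) (sum-replicate-zero n) ⟩
  f zero + 0                 ≡⟨ +-identityʳ (f zero) ⟩
  f zero                     ∎
∑-single {suc n} f (suc a) f≡0 =
  trans (cong (_+ sum (f ∘ suc)) (f≡0 zero λ ()))
        (∑-single (f ∘ suc) a (λ i i≢a → f≡0 (suc i) (i≢a ∘ Fin.suc-injective)))

≤-∑ : ∀ {n} (f : Fin n → ℕ) i → f i ≤ sum f
≤-∑ f zero    = m≤m+n _ _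
≤-∑ f (suc i) = ≤-trans (≤-∑ (f ∘ suc) i) (m≤n+m _ _)

+-≤-∑ : ∀ {n} (f : Fin n → ℕ) {i j} → i ≢ j → f i + f j ≤ sum f
+-≤-∑ f {zero}  {zero}  i≢j = contradiction refl i≢j
+-≤-∑ f {zero}  {suc j} _   = +-monoʳ-≤ (f zero) (≤-∑ (f ∘ suc) j)
+-≤-∑ f {suc i} {zero}  i≢j = subst (_≤ sum f) (+-comm (f zero) (f (suc i))) (+-≤-∑ f (i≢j ∘ sym))
+-≤-∑ f {suc i} {suc j} i≢j = ≤-trans (+-≤-∑ (f ∘ suc) (i≢j ∘ cong suc)) (m≤n+m _ _)

module WalkProperties {n : ℕ} (G : Graph n) where

  infixl 5 _∷ʳ_
  infixr 5 _++_

  _∷ʳ_ : ∀ {a b c k} → Walk G a b k → Adj G b c → Walk G a c (suc k)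
  here     ∷ʳ e′ = step e′ here
  step e W ∷ʳ e′ = step e (W ∷ʳ e′)

  reverse : ∀ {a b k} → Walk G a b k → Walk G b a k
  reverse here       = here
  reverse (step e W) = reverse W ∷ʳ Adj-sym G e

  _++_ : ∀ {a b c k l} → Walk G a b k → Walk G b c l → Walk G a c (k + l)
  here     ++ W′ = W′
  step e W ++ W′ = step e (W ++ W′)

  walk₀⇒≡ : ∀ {a b} → Walk G a b 0 → a ≡ b
  walk₀⇒≡ here = refl

  walk₁⇒Adj : ∀ {a b} → Walk G a b 1 → Adj G a b
  walk₁⇒Adj (step e here) = e

  AllOn : (Fin n → Set) → ∀ {a b k} → Walk G a b k → Set
  AllOn P (here {u})     = P u
  AllOn P (step {u} _ W) = P u × AllOn P W

  module _ {P : Fin n → Set} where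

    AllOn-∷ʳ : ∀ {a b c k} (W : Walk G a b k) (e : Adj G b c) → AllOn P W → P c → AllOn P (W ∷ʳ e)
    AllOn-∷ʳ here       _ pa        pc = pa , pc
    AllOn-∷ʳ (step _ W) e (pu , pW) pc = pu , AllOn-∷ʳ W e pW pc

    AllOn-reverse : ∀ {a b k} (W : Walk G a b k) → AllOn P W → AllOn P (reverse W)
    AllOn-reverse here       pa        = pa
    AllOn-reverse (step _ W) (pu , pW) = AllOn-∷ʳ (reverse W) _ (AllOn-reverse W pW) pu

    AllOn-++ : ∀ {a b c k l} (W : Walk G a b k) (W′ : Walk G b c l) →
               AllOn P W → AllOn P W′ → AllOn P (W ++ W′)
    AllOn-++ here       _  _         pW′ = pW′
    AllOn-++ (step _ W) W′ (pu , pW) pW′ = pu , AllOn-++ W W′ pW pW′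

  IsPath : ∀ {a b k} → Walk G a b k → Set
  IsPath here           = ⊤
  IsPath (step {u} _ W) = AllOn (u ≢_) W × IsPath W

  PathWithin : (Fin n → Set) → Fin n → Fin n → Set
  PathWithin P a b = ∃[ k ] Σ (Walk G a b k) λ W → IsPath W × AllOn P W

  module _ {P : Fin n → Set} where

    dropUntil : ∀ x {a b k} (W : Walk G a b k) → IsPath W → AllOn P W →
                AllOn (x ≢_) W ⊎ PathWithin P x b
    dropUntil x (here {u}) _ pu with x ≟ u
    ... | yes refl = inj₂ (_ , here , tt , pu)
    ... | no x≢u   = inj₁ x≢u
    dropUntil x (step {u} e W) path@(_ , pathW) pW@(_ , pW′) with x ≟ u
    ... | yes refl = inj₂ (_ , step e W , path , pW)
    ... | no x≢u   = ⊎-map₁ (x≢u ,_) (dropUntil x W pathW pW′)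

    loopErase : ∀ {a b k} (W : Walk G a b k) → AllOn P W → PathWithin P a b
    loopErase here pa = _ , here , tt , pa
    loopErase (step {u} e W) (pu , pW) with loopErase W pW
    ... | _ , W′ , path , pW′ with dropUntil u W′ path pW′
    ...   | inj₁ u∉W′ = _ , step e W′ , (u∉W′ , path) , (pu , pW′)
    ...   | inj₂ fromU = fromU

  vertex : ∀ {a b k} → Walk G a b k → Fin (suc k) → Fin n
  vertex (here {u})     zero    = u
  vertex (step {u} _ _) zero    = u
  vertex (step _ W)     (suc i) = vertex W i

  vertex-adjacent : ∀ {a b k} (W : Walk G a b k) (i : Fin k) →
                    Adj G (vertex W (inject₁ i)) (vertex W (suc i))
  vertex-adjacent (step e here)       zero    = e
  vertex-adjacent (step e (step _ _)) zero    = e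
  vertex-adjacent (step _ W)          (suc i) = vertex-adjacent W i

  vertex-last : ∀ {a b k} (W : Walk G a b k) → vertex W (fromℕ k) ≡ b
  vertex-last here       = refl
  vertex-last (step _ W) = vertex-last W

  AllOn⇒vertex : ∀ {P a b k} (W : Walk G a b k) → AllOn P W → ∀ i → P (vertex W i)
  AllOn⇒vertex here       pa       zero    = pa
  AllOn⇒vertex (step _ W) (pu , _) zero    = pu
  AllOn⇒vertex (step _ W) (_ , pW) (suc i) = AllOn⇒vertex W pW i

  vertex-injective : ∀ {a b k} (W : Walk G a b k) → IsPath W → Injective _≡_ _≡_ (vertex W)
  vertex-injective here       _          {zero}  {zero}  _ = refl
  vertex-injective (step _ W) _          {zero}  {zero}  _ = refl
  vertex-injective (step _ W) (u∉W , _)  {zero}  {suc j} e = contradiction e (AllOn⇒vertex W u∉W j)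
  vertex-injective (step _ W) (u∉W , _)  {suc i} {zero}  e = contradiction (sym e) (AllOn⇒vertex W u∉W i)
  vertex-injective (step _ W) (_ , path) {suc i} {suc j} e = cong suc (vertex-injective W path e)

  closePath : ∀ {a b m} (W : Walk G a b (2 + m)) → IsPath W → Adj G b a → Cycle G
  closePath {m = m} W@(step _ _) path ba = record
    { m        = m
    ; vert     = vertex W
    ; distinct = vertex-injective W path
    ; consec   = vertex-adjacent W
    ; closing  = subst (λ z → Adj G z _) (sym (vertex-last W)) ba
    }

  acyclic⇒no-detour : Acyclic G → ∀ {v a b k} → Adj G v a → Adj G b v → a ≢ b →
                      (W : Walk G a b k) → AllOn (v ≢_) W → ⊥
  acyclic⇒no-detour acyclic va bv a≢b W v∉W with loopErase W v∉W
  ... | _ , here , _ = a≢b refl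
  ... | _ , W′@(step _ _) , path , v∉W′ = acyclic (closePath (step va W′) (v∉W′ , path) bv)

module DistanceProperties {n : ℕ} (G : Graph n) (acyclic : Acyclic G)
       (d : Fin n → Fin n → ℕ) (isDist : ∀ u v → IsDist G u v (d u v)) where

  open WalkProperties G

  geodesic : ∀ u v → Walk G u v (d u v)
  geodesic u v = proj₁ (isDist u v)

  d-minimal : ∀ {u v k} → Walk G u v k → d u v ≤ k
  d-minimal {u} {v} = proj₂ (isDist u v)

  d-sym : ∀ u v → d u v ≡ d v u
  d-sym u v = ≤-antisym (d-minimal (reverse (geodesic v u))) (d-minimal (reverse (geodesic u v)))

  d-refl : ∀ u → d u u ≡ 0
  d-refl u = n≤0⇒n≡0 (d-minimal here)

  d≡0⇒≡ : ∀ {u v} → d u v ≡ 0 → u ≡ v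
  d≡0⇒≡ {u} {v} eq = walk₀⇒≡ (subst (Walk G u v) eq (geodesic u v))

  d≡1⇒adj : ∀ {u v} → d u v ≡ 1 → Adj G u v
  d≡1⇒adj {u} {v} eq = walk₁⇒Adj (subst (Walk G u v) eq (geodesic u v))

  adj⇒d≡1 : ∀ {u v} → Adj G u v → d u v ≡ 1
  adj⇒d≡1 e = ≤-antisym (d-minimal (step e here))
                        (n≢0⇒n>0 (λ eq → irrefl G (subst (Adj G _) (sym (d≡0⇒≡ eq)) e)))

  d-step : ∀ x {u v} → Adj G u v → d x v ≤ suc (d x u)
  d-step x {u} e = d-minimal (geodesic x u ∷ʳ e)

  -- The bound says that W is a tail of a geodesic from x to a, so its vertices other
  -- than a are strictly closer to x than a, hence different from v.
  geodesic-avoids : ∀ {x a v} → v ≢ a → d x a ≤ d x v →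
                    ∀ {w k} (W : Walk G w a k) → d x w + k ≤ d x a → AllOn (v ≢_) W
  geodesic-avoids v≢a _ here _ = v≢a
  geodesic-avoids {x} {a} v≢a a≤v (step {u} {k = k} e W) bound =
      (λ { refl → <-irrefl refl (<-≤-trans (≤-trans (s≤s (m≤m+n _ _)) bound′) a≤v) })
    , geodesic-avoids v≢a a≤v W (≤-trans (+-monoˡ-≤ k (d-step x e)) bound′)
    where
      bound′ : suc (d x u + k) ≤ d x a
      bound′ = subst (_≤ d x a) (+-suc _ k) bound

  not-farther-neighbour-unique : ∀ {x v a b} → Adj G v a → Adj G v b →
                                 d x a ≤ d x v → d x b ≤ d x v → a ≡ b
  not-farther-neighbour-unique {x} {v} {a} {b} va vb a≤v b≤v with a ≟ b
  ... | yes a≡b = a≡b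
  ... | no a≢b  = ⊥-elim (acyclic⇒no-detour acyclic va (Adj-sym G vb) a≢b
                    (reverse (geodesic x a) ++ geodesic x b)
                    (AllOn-++ (reverse (geodesic x a)) (geodesic x b)
                      (AllOn-reverse (geodesic x a) (avoids va a≤v)) (avoids vb b≤v)))
    where
      avoids : ∀ {c} → Adj G v c → d x c ≤ d x v → AllOn (v ≢_) (geodesic x c)
      avoids {c} vc c≤v = geodesic-avoids (λ { refl → irrefl G vc }) c≤v (geodesic x c)
                                          (≤-reflexive (cong (_+ d x c) (d-refl x)))

  closer-neighbour : ∀ {x v} → x ≢ v → ∃[ c ] Adj G v c × d x c < d x v
  closer-neighbour {x} {v} x≢v with d v x in eq | geodesic v x
  ... | zero  | _ = contradiction (sym (d≡0⇒≡ eq)) x≢v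
  ... | suc k | step {w = c} vc W =
    c , vc , subst₂ _<_ (d-sym c x) (trans (sym eq) (d-sym v x)) (s≤s (d-minimal W))

  d-adjacent : ∀ x {u v} → Adj G u v → d x v ≡ suc (d x u) ⊎ d x u ≡ suc (d x v)
  d-adjacent x {u} {v} e with <-cmp (d x u) (d x v)
  ... | tri< u<v _ _ = inj₁ (≤-antisym (d-step x e) u<v)
  ... | tri> _ _ v<u = inj₂ (≤-antisym (d-step x (Adj-sym G e)) v<u)
  ... | tri≈ _ u≡v _ = ⊥-elim (equidistant (x ≟ u))
    where
      equidistant : Dec (x ≡ u) → ⊥
      equidistant (yes refl) =
        irrefl G (subst (Adj G x) (sym (d≡0⇒≡ (trans (sym u≡v) (d-refl x)))) e)
      equidistant (no x≢u) with closer-neighbour x≢u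
      ... | p , up , p<u =
        <-irrefl (sym u≡v)
          (subst (λ c → d x c < d x u)
                 (not-farther-neighbour-unique up e (<⇒≤ p<u) (≤-reflexive (sym u≡v))) p<u)

module TreeStatus {n : ℕ} (G : Graph n) (acyclic : Acyclic G)
       (s : Fin n → ℕ) (isStatus : StatusFunction G s) where

  d : Fin n → Fin n → ℕ
  d v = proj₁ (isStatus v)

  open DistanceProperties G acyclic d (λ v → proj₁ (proj₂ (isStatus v)))

  s≡∑d : ∀ v → s v ≡ sum (d v)
  s≡∑d v = trans (proj₂ (proj₂ (isStatus v))) (sum-tabulate (d v))

  adjacent? : ∀ u v → Dec (Adj G u v)
  adjacent? u v = map′ d≡1⇒adj adj⇒d≡1 (d u v ℕ.≟ 1)

  -- For an edge uv, the size of the component of G - uv containing v.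
  branch : Fin n → Fin n → ℕ
  branch u v = ∑[ x < n ] when (d x v <? d x u) 1

  branch-complement : ∀ {u v} → Adj G u v → branch u v + branch v u ≡ n
  branch-complement {u} {v} e = begin
    branch u v + branch v u
      ≡⟨ ∑-distrib-+ (λ x → when (d x v <? d x u) 1) _ ⟨
    ∑[ x < n ] (when (d x v <? d x u) 1 + when (d x u <? d x v) 1)
      ≡⟨ sum-cong-≗ (λ x → when-<-adjacent (d-adjacent x e)) ⟩
    ∑[ x < n ] 1
      ≡⟨ ∑-one n ⟩
    n ∎

  status-edge : ∀ {u v} → Adj G u v → s v + branch u v ≡ s u + branch v u
  status-edge {u} {v} e = begin
    s v + branch u v                               ≡⟨ cong (_+ branch u v) (s≡∑d v) ⟩
    sum (d v) + branch u v                         ≡⟨ ∑-distrib-+ (d v) _ ⟨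
    ∑[ x < n ] (d v x + when (d x v <? d x u) 1)  ≡⟨ sum-cong-≗ shift ⟩
    ∑[ x < n ] (d u x + when (d x u <? d x v) 1)  ≡⟨ ∑-distrib-+ (d u) _ ⟩
    sum (d u) + branch v u                         ≡⟨ cong (_+ branch v u) (s≡∑d u) ⟨
    s u + branch v u                               ∎
    where
      shift : ∀ x → d v x + when (d x v <? d x u) 1 ≡ d u x + when (d x u <? d x v) 1
      shift x rewrite d-sym v x | d-sym u x = +-when-<-adjacent (d-adjacent x e)

  closer-neighbour-count : ∀ v x →
    ∑[ c < n ] when (adjacent? v c) (when (d x c <? d x v) 1) + when (x ≟ v) 1 ≡ 1
  closer-neighbour-count v x with x ≟ v
  ... | yes refl = cong (_+ 1) (trans (sum-cong-≗ none) (sum-replicate-zero n))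
    where
      none : ∀ c → when (adjacent? x c) (when (d x c <? d x x) 1) ≡ 0
      none c with adjacent? x c | d x c <? d x x
      ... | yes _ | yes c<x = contradiction (subst (d x c <_) (d-refl x) c<x) n≮0
      ... | yes _ | no _    = refl
      ... | no _  | _       = refl
  ... | no x≢v with closer-neighbour x≢v
  ...   | c₀ , vc₀ , c₀<v = begin
    ∑[ c < n ] when (adjacent? v c) (when (d x c <? d x v) 1) + 0 ≡⟨ +-identityʳ _ ⟩
    ∑[ c < n ] when (adjacent? v c) (when (d x c <? d x v) 1)     ≡⟨ ∑-single _ c₀ others ⟩
    when (adjacent? v c₀) (when (d x c₀ <? d x v) 1)              ≡⟨ when-yes (adjacent? v c₀) vc₀ ⟩
    when (d x c₀ <? d x v) 1                                       ≡⟨ when-yes (d x c₀ <? d x v) c₀<v ⟩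
    1                                                              ∎
    where
      others : ∀ c → c ≢ c₀ → when (adjacent? v c) (when (d x c <? d x v) 1) ≡ 0
      others c c≢c₀ with adjacent? v c | d x c <? d x v
      ... | yes vc | yes c<v = contradiction (not-farther-neighbour-unique vc vc₀ (<⇒≤ c<v) (<⇒≤ c₀<v)) c≢c₀
      ... | yes _  | no _    = refl
      ... | no _   | _       = refl

  branches-partition : ∀ v → suc (∑[ c < n ] when (adjacent? v c) (branch v c)) ≡ n
  branches-partition v = begin
    suc (∑[ c < n ] when (adjacent? v c) (branch v c))          ≡⟨ +-comm 1 _ ⟩
    ∑[ c < n ] when (adjacent? v c) (branch v c) + 1            ≡⟨ cong₂ _+_ swap only-v ⟩
    ∑[ x < n ] closer x + ∑[ x < n ] when (x ≟ v) 1            ≡⟨ ∑-distrib-+ closer _ ⟨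
    ∑[ x < n ] (closer x + when (x ≟ v) 1)                     ≡⟨ sum-cong-≗ (closer-neighbour-count v) ⟩
    ∑[ x < n ] 1                                                ≡⟨ ∑-one n ⟩
    n                                                           ∎
    where
      closer : Fin n → ℕ
      closer x = ∑[ c < n ] when (adjacent? v c) (when (d x c <? d x v) 1)
      swap : ∑[ c < n ] when (adjacent? v c) (branch v c) ≡ ∑[ x < n ] closer x
      swap = trans (sum-cong-≗ (λ c → when-sum (adjacent? v c) (λ x → when (d x c <? d x v) 1)))
                   (∑-comm (λ c x → when (adjacent? v c) (when (d x c <? d x v) 1)))
      only-v : 1 ≡ ∑[ x < n ] when (x ≟ v) 1
      only-v = sym (trans (∑-single _ v (λ x → when-no (x ≟ v))) (when-yes (v ≟ v) refl))

  branch-pair< : ∀ {x a b} → Adj G x a → Adj G x b → a ≢ b → branch x a + branch x b < n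
  branch-pair< {x} {a} {b} xa xb a≢b =
    subst (branch x a + branch x b <_) (branches-partition x)
          (s≤s (subst₂ (λ l r → l + r ≤ _) (when-yes (adjacent? x a) xa) (when-yes (adjacent? x b) xb)
                        (+-≤-∑ (λ c → when (adjacent? x c) (branch x c)) a≢b)))

module _ {n : ℕ} where

  -- In a status-injective tree with subtree sizes β (rooted at the vertex of least status),
  -- this is exactly the relation "p is the parent of c"; see parent⇔downhill below.
  Parent : (s β : Fin n → ℕ) → Fin n → Fin n → Set
  Parent s β p c = s p < s c × β c ≢ n × s c + (β c + β c) ≡ s p + n

  parent? : ∀ s β p c → Dec (Parent s β p c)
  parent? s β p c =
    (s p <? s c) ×-dec (¬? (β c ℕ.≟ n) ×-dec (s c + (β c + β c) ℕ.≟ s p + n))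

  Linked : (s β : Fin n → ℕ) → Fin n → Fin n → Set
  Linked s β u v = Parent s β u v ⊎ Parent s β v u

  IsSubtreeSize : (s β : Fin n → ℕ) → Set
  IsSubtreeSize s β = ∀ x → β x ≡ suc (∑[ c < n ] when (parent? s β x c) (β c))

  module _ {s₁ s₂ β₁ β₂ : Fin n → ℕ} where

    Parent-cong : ∀ {p c} → s₁ p ≡ s₂ p → s₁ c ≡ s₂ c → β₁ c ≡ β₂ c →
                  Parent s₁ β₁ p c ⇔ Parent s₂ β₂ p c
    Parent-cong {p} {c} sp sc βc = mk⇔
      (λ (p<c , β≢n , eq) → subst₂ _<_ sp sc p<c , β≢n ∘ trans βc ,
         trans (cong₂ (λ a b → a + (b + b)) (sym sc) (sym βc)) (trans eq (cong (_+ n) sp)))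
      (λ (p<c , β≢n , eq) → subst₂ _<_ (sym sp) (sym sc) p<c , β≢n ∘ trans (sym βc) ,
         trans (cong₂ (λ a b → a + (b + b)) sc βc) (trans eq (cong (_+ n) (sym sp))))

    Linked-cong : s₁ ≗ s₂ → β₁ ≗ β₂ → ∀ {u v} → Linked s₁ β₁ u v ⇔ Linked s₂ β₂ u v
    Linked-cong s≗ β≗ {u} {v} = mk⇔
      (⊎-map (Equivalence.to   (Parent-cong (s≗ u) (s≗ v) (β≗ v)))
             (Equivalence.to   (Parent-cong (s≗ v) (s≗ u) (β≗ u))))
      (⊎-map (Equivalence.from (Parent-cong (s≗ u) (s≗ v) (β≗ v)))
             (Equivalence.from (Parent-cong (s≗ v) (s≗ u) (β≗ u))))

    -- Children have larger status, so the recursion can be unfolded downwards from the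
    -- largest status; the fuel k measures the distance to a bound on all statuses.
    subtreeSize-unique : s₁ ≗ s₂ → IsSubtreeSize s₁ β₁ → IsSubtreeSize s₂ β₂ → β₁ ≗ β₂
    subtreeSize-unique s≗ fix₁ fix₂ x = downward (suc (sum s₁)) x (s≤s (m≤m+n (sum s₁) (s₁ x)))
      where
        downward : ∀ k x → sum s₁ < k + s₁ x → β₁ x ≡ β₂ x
        downward zero    x bound = contradiction bound (≤⇒≯ (≤-∑ s₁ x))
        downward (suc k) x bound = begin
          β₁ x                                             ≡⟨ fix₁ x ⟩
          suc (∑[ c < n ] when (parent? s₁ β₁ x c) (β₁ c)) ≡⟨ cong suc (sum-cong-≗ child) ⟩
          suc (∑[ c < n ] when (parent? s₂ β₂ x c) (β₂ c)) ≡⟨ fix₂ x ⟨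
          β₂ x                                             ∎
          where
            child : ∀ c → when (parent? s₁ β₁ x c) (β₁ c) ≡ when (parent? s₂ β₂ x c) (β₂ c)
            child c = when-cong (parent? s₁ β₁ x c) (parent? s₂ β₂ x c)
              (mk⇔ (λ par → Equivalence.to (Parent-cong′ (proj₁ par)) par)
                   (λ par → Equivalence.from (Parent-cong′ (s₂<⇒s₁< (proj₁ par))) par))
              (βc≡ ∘ proj₁)
              where
                s₂<⇒s₁< : s₂ x < s₂ c → s₁ x < s₁ c
                s₂<⇒s₁< = subst₂ _<_ (sym (s≗ x)) (sym (s≗ c))
                βc≡ : s₁ x < s₁ c → β₁ c ≡ β₂ c
                βc≡ x<c = downward k c
                  (≤-trans bound (subst (_≤ k + s₁ c) (+-suc k (s₁ x)) (+-monoʳ-≤ k x<c)))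
                Parent-cong′ : s₁ x < s₁ c → Parent s₁ β₁ x c ⇔ Parent s₂ β₂ x c
                Parent-cong′ x<c = Parent-cong (s≗ x) (s≗ c) (βc≡ x<c)

  IsSubtreeSize-permute : ∀ {s β} (π : Permutation n n) → IsSubtreeSize s β →
                          IsSubtreeSize (s ∘ (π ⟨$⟩ʳ_)) (β ∘ (π ⟨$⟩ʳ_))
  IsSubtreeSize-permute {s} {β} π fix x =
    trans (fix (π ⟨$⟩ʳ x)) (cong suc (∑-permute (λ c → when (parent? s β (π ⟨$⟩ʳ x) c) (β c)) π))

module InjectiveStatusTree {n : ℕ} (G : Graph n) (acyclic : Acyclic G)
       (s : Fin n → ℕ) (isStatus : StatusFunction G s) (injective : Injective _≡_ _≡_ s) where

  open TreeStatus G acyclic s isStatus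

  Downhill Uphill : Fin n → Fin n → Set
  Downhill x c = Adj G x c × s c < s x
  Uphill   x c = Adj G x c × s x < s c

  downhill? : ∀ x c → Dec (Downhill x c)
  downhill? x c = adjacent? x c ×-dec (s c <? s x)

  uphill? : ∀ x c → Dec (Uphill x c)
  uphill? x c = adjacent? x c ×-dec (s x <? s c)

  uphill⇔downhill : ∀ {x c} → Uphill x c ⇔ Downhill c x
  uphill⇔downhill = mk⇔ (λ (xc , x<c) → Adj-sym G xc , x<c) (λ (cx , x<c) → Adj-sym G cx , x<c)

  adjacent⇒status≢ : ∀ {u v} → Adj G u v → s u ≢ s v
  adjacent⇒status≢ e eq with injective eq
  ... | refl = irrefl G e

  downhill-branch : ∀ {x p} → Downhill x p → branch p x < branch x p
  downhill-branch {x} {p} (xp , p<x) =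
    +-cancelˡ-< (s x) _ _ (subst (_< s x + branch x p) (status-edge xp) (+-monoˡ-< (branch x p) p<x))

  -- Two distinct branches at x miss x itself, so p ≢ c would give
  -- branch x c < branch p x < branch x p and, symmetrically, branch x p < branch x c.
  downhill-unique : ∀ {x p c} → Downhill x p → Downhill x c → p ≡ c
  downhill-unique {x} {p} {c} dp@(xp , _) dc@(xc , _) with p ≟ c
  ... | yes p≡c = p≡c
  ... | no p≢c  = contradiction (smaller dc xp (p≢c ∘ sym)) (<-asym (smaller dp xc p≢c))
    where
      smaller : ∀ {a b} → Downhill x a → Adj G x b → a ≢ b → branch x b < branch x a
      smaller {a} {b} da@(xa , _) xb a≢b =
        <-trans (+-cancelˡ-< (branch x a) _ _
                  (subst (branch x a + branch x b <_) (sym (branch-complement xa))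
                         (branch-pair< xa xb a≢b)))
                (downhill-branch da)

  subtree : Fin n → ℕ
  subtree x = suc (∑[ c < n ] when (uphill? x c) (branch x c))

  adjacent-split : ∀ x c → when (adjacent? x c) (branch x c) ≡
                           when (downhill? x c) (branch x c) + when (uphill? x c) (branch x c)
  adjacent-split x c with adjacent? x c | s c <? s x | s x <? s c
  ... | no _  | _       | _       = refl
  ... | yes _ | yes _   | no _    = sym (+-identityʳ _)
  ... | yes _ | no _    | yes _   = refl
  ... | yes _ | yes c<x | yes x<c = contradiction x<c (<-asym c<x)
  ... | yes e | no c≮x  | no x≮c = contradiction (≤-antisym (≮⇒≥ c≮x) (≮⇒≥ x≮c)) (adjacent⇒status≢ e)

  subtree-complement : ∀ x → ∑[ c < n ] when (downhill? x c) (branch x c) + subtree x ≡ n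
  subtree-complement x = begin
    down + suc up                                          ≡⟨ +-suc down up ⟩
    suc (down + up)                                        ≡⟨ cong suc (∑-distrib-+ (λ c → when (downhill? x c) (branch x c)) _) ⟨
    suc (∑[ c < n ] (when (downhill? x c) (branch x c) + when (uphill? x c) (branch x c)))
                                                           ≡⟨ cong suc (sum-cong-≗ (adjacent-split x)) ⟨
    suc (∑[ c < n ] when (adjacent? x c) (branch x c))     ≡⟨ branches-partition x ⟩
    n                                                      ∎
    where
      down = ∑[ c < n ] when (downhill? x c) (branch x c)
      up   = ∑[ c < n ] when (uphill? x c) (branch x c)

  subtree-root : ∀ {x} → (∀ c → ¬ Downhill x c) → subtree x ≡ n
  subtree-root {x} none = trans (cong (_+ subtree x) (sym no-down)) (subtree-complement x)
    where
      no-down : ∑[ c < n ] when (downhill? x c) (branch x c) ≡ 0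
      no-down = trans (sum-cong-≗ (λ c → when-no (downhill? x c) (none c))) (sum-replicate-zero n)

  subtree-below : ∀ {x p} → Downhill x p → subtree x ≡ branch p x
  subtree-below {x} {p} dp@(xp , _) = +-cancelˡ-≡ (branch x p) _ _ (begin
    branch x p + subtree x                                  ≡⟨ cong (_+ subtree x) only-p ⟨
    ∑[ c < n ] when (downhill? x c) (branch x c) + subtree x ≡⟨ subtree-complement x ⟩
    n                                                       ≡⟨ branch-complement xp ⟨
    branch x p + branch p x                                 ∎)
    where
      only-p : ∑[ c < n ] when (downhill? x c) (branch x c) ≡ branch x p
      only-p = trans (∑-single _ p (λ c c≢p → when-no (downhill? x c) (λ dc → c≢p (downhill-unique dc dp))))
                     (when-yes (downhill? x p) dp)

  subtree-below≢n : ∀ {x p} → Downhill x p → subtree x ≢ n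
  subtree-below≢n {x} {p} dp@(xp , _) subtree≡n =
    <-irrefl refl (<-≤-trans (downhill-branch dp)
                             (≤-trans (m≤m+n (branch x p) (branch p x)) (≤-reflexive B+A≡B)))
    where
      B+A≡B : branch x p + branch p x ≡ branch p x
      B+A≡B = trans (branch-complement xp) (trans (sym subtree≡n) (subtree-below dp))

  status-below : ∀ {x p} → Downhill x p → s x + (subtree x + subtree x) ≡ s p + n
  status-below {x} {p} dp@(xp , _) = begin
    s x + (subtree x + subtree x)       ≡⟨ cong (λ m → s x + (m + m)) (subtree-below dp) ⟩
    s x + (branch p x + branch p x)     ≡⟨ +-assoc (s x) _ _ ⟨
    s x + branch p x + branch p x       ≡⟨ cong (_+ branch p x) (status-edge xp) ⟨
    s p + branch x p + branch p x       ≡⟨ +-assoc (s p) _ _ ⟩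
    s p + (branch x p + branch p x)     ≡⟨ cong (s p +_) (branch-complement xp) ⟩
    s p + n                             ∎

  -- The parent of c is recovered from its status equation, as statuses are distinct.
  parent⇔downhill : ∀ {p c} → Parent s subtree p c ⇔ Downhill c p
  parent⇔downhill {p} {c} = mk⇔ to (λ dp@(_ , p<c) → p<c , subtree-below≢n dp , status-below dp)
    where
      to : Parent s subtree p c → Downhill c p
      to (_ , subtree≢n , eq) with Fin.any? (downhill? c)
      ... | no none = contradiction (subtree-root (λ q dq → none (q , dq))) subtree≢n
      ... | yes (q , dq) with injective (+-cancelʳ-≡ n _ _ (trans (sym (status-below dq)) eq))
      ...   | refl = dq

  subtree-isSubtreeSize : IsSubtreeSize s subtree
  subtree-isSubtreeSize x = cong suc (sum-cong-≗ λ c →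
    when-cong (uphill? x c) (parent? s subtree x c)
      (⇔.trans uphill⇔downhill (⇔.sym parent⇔downhill))
      (sym ∘ subtree-below ∘ Equivalence.to uphill⇔downhill))

  adjacent⇔linked : ∀ {u v} → Adj G u v ⇔ Linked s subtree u v
  adjacent⇔linked {u} {v} = mk⇔ to from
    where
      to : Adj G u v → Linked s subtree u v
      to e with <-cmp (s u) (s v)
      ... | tri< u<v _ _ = inj₁ (Equivalence.from parent⇔downhill (Adj-sym G e , u<v))
      ... | tri≈ _ u≡v _ = contradiction u≡v (adjacent⇒status≢ e)
      ... | tri> _ _ v<u = inj₂ (Equivalence.from parent⇔downhill (e , v<u))
      from : Linked s subtree u v → Adj G u v
      from (inj₁ par) = Adj-sym G (proj₁ (Equivalence.to parent⇔downhill par))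
      from (inj₂ par) = proj₁ (Equivalence.to parent⇔downhill par)

module _ {A : Set} where

  ↭-tabulate-match : ∀ {m n} {f : Fin m → A} {g : Fin n → A} →
                     tabulate f ↭ tabulate g → ∀ i → ∃[ j ] f i ≡ g j
  ↭-tabulate-match f↭g i = ∈-tabulate⁻ (∈-resp-↭ f↭g (∈-tabulate⁺ i))

  Unique-tabulate⇒injective : ∀ {n} {f : Fin n → A} → Unique (tabulate f) → Injective _≡_ _≡_ f
  Unique-tabulate⇒injective         u         {zero}  {zero}  _  = refl
  Unique-tabulate⇒injective {f = f} u         {zero}  {suc j} eq =
    contradiction (subst (_∈ tabulate (f ∘ suc)) (sym eq) (∈-tabulate⁺ j)) (Unique[x∷xs]⇒x∉xs u)
  Unique-tabulate⇒injective {f = f} u         {suc i} {zero}  eq =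
    contradiction (subst (_∈ tabulate (f ∘ suc)) eq (∈-tabulate⁺ i)) (Unique[x∷xs]⇒x∉xs u)
  Unique-tabulate⇒injective         (_ ∷ u)   {suc i} {suc j} eq =
    cong suc (Unique-tabulate⇒injective u eq)

  ↭-tabulate⇒permutation : ∀ {m n} {f : Fin m → A} {g : Fin n → A} → Injective _≡_ _≡_ g →
                           tabulate f ↭ tabulate g → Σ (Permutation m n) λ π → ∀ i → g (π ⟨$⟩ʳ i) ≡ f i
  ↭-tabulate⇒permutation {f = f} {g} g-injective f↭g =
    permutation to from (λ j → g-injective (to-from j)) (λ i → f-injective (from-to i)) ,
    λ i → sym (proj₂ (↭-tabulate-match f↭g i))
    where
      f-injective : Injective _≡_ _≡_ f
      f-injective = Unique-tabulate⇒injective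
        (↭ₛ.Unique-resp-↭ (setoid A) (↭⇒↭ₛ (↭-sym f↭g)) (tabulate⁺ g-injective))
      to : Fin _ → Fin _
      to i = proj₁ (↭-tabulate-match f↭g i)
      from : Fin _ → Fin _
      from j = proj₁ (↭-tabulate-match (↭-sym f↭g) j)
      to-from : ∀ j → g (to (from j)) ≡ g j
      to-from j = trans (sym (proj₂ (↭-tabulate-match f↭g (from j))))
                        (sym (proj₂ (↭-tabulate-match (↭-sym f↭g) j)))
      from-to : ∀ i → f (from (to i)) ≡ f i
      from-to i = trans (sym (proj₂ (↭-tabulate-match (↭-sym f↭g) (to i))))
                        (sym (proj₂ (↭-tabulate-match f↭g i)))

statusSeq-↭ : ∀ {m n} {f : Fin m → ℕ} {g : Fin n → ℕ} → statusSeq f ≡ statusSeq g →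
              tabulate f ↭ tabulate g
statusSeq-↭ {f = f} {g} eq =
  ↭-trans (↭-sym (sort-↭ (tabulate f))) (subst (_↭ tabulate g) (sym eq) (sort-↭ (tabulate g)))
  where open Data.List.Sort ≤-decTotalOrder using (sort-↭)

theorem3p1 : ∀ {n n′} (T : Graph n) (T′ : Graph n′)
             (s : Fin n → ℕ) (s′ : Fin n′ → ℕ) →
             IsTree T → IsTree T′ →
             StatusFunction T s → StatusFunction T′ s′ →
             Injective _≡_ _≡_ s →
             statusSeq s′ ≡ statusSeq s →
             Iso T′ T
theorem3p1 T T′ s s′ (_ , _ , acyclic) (_ , _ , acyclic′) isStatus isStatus′ injective σ≡
  with ↭-tabulate⇒permutation injective (statusSeq-↭ σ≡)
... | π , s∘π≗s′ with ↔⇒≡ π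
... | refl = record { bij = ↔⇒⤖ π ; pres = λ u v → adjacency }
  where
    injective′ : Injective _≡_ _≡_ s′
    injective′ eq = Bijection.injective (↔⇒⤖ π) (injective (trans (s∘π≗s′ _) (trans eq (sym (s∘π≗s′ _)))))
    module 𝒯  = InjectiveStatusTree T  acyclic  s  isStatus  injective
    module 𝒯′ = InjectiveStatusTree T′ acyclic′ s′ isStatus′ injective′
    subtree∘π≗subtree′ : 𝒯.subtree ∘ (π ⟨$⟩ʳ_) ≗ 𝒯′.subtree
    subtree∘π≗subtree′ = subtreeSize-unique s∘π≗s′
      (IsSubtreeSize-permute π 𝒯.subtree-isSubtreeSize) 𝒯′.subtree-isSubtreeSize
    adjacency : ∀ {u v} → Adj T′ u v ⇔ Adj T (π ⟨$⟩ʳ u) (π ⟨$⟩ʳ v)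
    adjacency = ⇔.trans 𝒯′.adjacent⇔linked
      (⇔.trans (Linked-cong (sym ∘ s∘π≗s′) (sym ∘ subtree∘π≗subtree′)) (⇔.sym 𝒯.adjacent⇔linked))
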